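{- Let $p$ be a prime, let $w_1,w_2,w_3$ be positive integers, let $y_1\in\mathbb{Z}_p$, and let $n\ge0$ be an integer. Then \begin{align*} &\sum_{k+\ell+m=n}\binom{n}{k,\ell,m}B_{k}(w_{1}y_{1})S_{\ell}(w_{2}-1)S_{m}(w_{3}-1)\,w_{1}^{\ell+m}w_{2}^{k+m-1}w_{3}^{k+\ell-1}\\ &=\sum_{k+\ell+m=n}\binom{n}{k,\ell,m}B_{k}(w_{2}y_{1})S_{\ell}(w_{3}-1)S_{m}(w_{1}-1)\,w_{2}^{\ell+m}w_{3}^{k+m-1}w_{1}^{k+\ell-1}\\ &=\sum_{k+\ell+m=n}\binom{n}{k,\ell,m}B_{k}(w_{3}y_{1})S_{\ell}(w_{1}-1)S_{m}(w_{2}-1)\,w_{3}^{\ell+m}w_{1}^{k+m-1}w_{2}^{k+\ell-1}. \end{align*}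
   Context: $\mathbb{Z}_p$ denotes the ring of $p$-adic integers. The Bernoulli polynomials $B_n(x)$ are defined by $\frac{t}{e^t-1}e^{xt}=\sum_{n\ge0}B_n(x)\frac{t^n}{n!}$. For integers $k,N\ge0$, $S_k(N)=\sum_{i=0}^{N}i^k$, with the convention $0^0=1$ (so $S_0(N)=N+1$ and $S_k(0)=0$ for $k>0$). Sums $\sum_{k+\ell+m=n}$ run over all nonnegative integers $k,\ell,m$ with $k+\ell+m=n$, and $\binom{n}{k,\ell,m}=\frac{n!}{k!\,\ell!\,m!}$. -}

module Defs where

open import Level using (Level)
open import Data.Nat as ℕ using (ℕ; zero; suc; _∸_; _!; NonZero)
open import Data.Nat.Properties using (_!≢0; m*n≢0)
open import Data.Nat.Combinatorics using (_C_)
open import Data.Integer as ℤ using (+_)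
open import Data.Rational as ℚ using (ℚ; _/_)
open import Data.List using (List; []; _∷_; _++_; map; upTo; zipWith; foldr; lookup; length; concatMap)
import Data.List as L
open import Data.Nat.ListAction using (sum)
open import Data.Product using (_×_; _,_)
open import Algebra.Bundles using (CommutativeRing)

Σℚ : List ℚ → ℚ
Σℚ = foldr ℚ._+_ ℚ.0ℚ

_^ℚ_ : ℚ → ℕ → ℚ
x ^ℚ zero = ℚ.1ℚ
x ^ℚ suc n = x ℚ.* (x ^ℚ n)

ι : ℕ → ℚ
ι n = (+ n) / 1

-- Bernoulli numbers (t/(e^t-1) convention, B₁ = -1/2), via the recursion
--   B₀ = 1,  B_n = -(1/(n+1)) Σ_{j<n} C(n+1,j) B_j  (n ≥ 1).
-- bernList n = [B₀, …, B_{n-1}]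
bernNext : ℕ → List ℚ → ℚ
bernNext zero bs = ℚ.1ℚ
bernNext (suc n) bs = ℚ.- (((+ 1) / suc (suc n)) ℚ.* Σℚ (zipWith (λ j b → ι (suc (suc n) C j) ℚ.* b) (upTo (suc n)) bs))

bernList : ℕ → List ℚ
bernList zero = []
bernList (suc n) = bernList n ++ (bernNext n (bernList n) ∷ [])

bernoulli : ℕ → ℚ
bernoulli n = bernNext n (bernList n)

-- S_k(N) = Σ_{i=0}^{N} i^k  (with 0^0 = 1)
S : ℕ → ℕ → ℕ
S k N = sum (map (λ i → i ℕ.^ k) (upTo (suc N)))

multinom : ℕ → ℕ → ℕ → ℕ → ℚ
multinom n k l m = (+ (n !)) / ((k !) ℕ.* ((l !) ℕ.* (m !)))
  where instance
          _ = k !≢0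
          _ = l !≢0
          _ = m !≢0
          _ = m*n≢0 (l !) (m !)
          _ = m*n≢0 (k !) ((l !) ℕ.* (m !))

triples : ℕ → List (ℕ × ℕ × ℕ)
triples n = concatMap (λ k → map (λ l → (k , l , n ∸ k ∸ l)) (upTo (suc (n ∸ k)))) (upTo (suc n))

module _ {c ℓ : Level} (R : CommutativeRing c ℓ) (φ : ℚ → CommutativeRing.Carrier R) where
  open CommutativeRing R

  ΣR : List Carrier → Carrier
  ΣR = foldr _+_ 0#

  _^R_ : Carrier → ℕ → Carrier
  x ^R zero = 1#
  x ^R suc n = x * (x ^R n)

  bernPoly : ℕ → Carrier → Carrier
  bernPoly n x = ΣR (map (λ j → φ (ι (n C j) ℚ.* bernoulli j) * (x ^R (n ∸ j))) (upTo (suc n)))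

  -- Σ_{k+ℓ+m=n} (n; k,ℓ,m) B_k(a y) S_ℓ(b-1) S_m(c-1) a^{ℓ+m} b^{k+m-1} c^{k+ℓ-1}
  -- for positive a b c; the rational factor b^{-1} c^{-1} handles the exponent -1.
  cyclicSum : (a b c' : ℕ) → .{{NonZero b}} → .{{NonZero c'}} → Carrier → ℕ → Carrier
  cyclicSum a b c' y n = ΣR (map term (triples n))
    where
      term : ℕ × ℕ × ℕ → Carrier
      term (k , l , m) =
        φ (multinom n k l m ℚ.* ι (S l (b ∸ 1)) ℚ.* ι (S m (c' ∸ 1))
             ℚ.* (ι a ^ℚ (l ℕ.+ m)) ℚ.* (ι b ^ℚ (k ℕ.+ m)) ℚ.* (ι c' ^ℚ (k ℕ.+ l))
             ℚ.* ((+ 1) / b) ℚ.* ((+ 1) / c'))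
        * bernPoly k (φ (ι a) * y)

{-# OPTIONS --safe #-}
module Submission where

-- Read the sums as coefficients of exponential generating functions, which multiply by
-- binomial convolution ⊛. With α, β, γ the images of a, b, c, the cyclic sum for weights (a, b, c)
-- at y is 1/(bc) times the coefficient sequence of
--   βγt e^{αβγyt}/(e^{βγt} − 1) · (e^{αβγt} − 1)/(e^{αγt} − 1) · (e^{αβγt} − 1)/(e^{αβt} − 1),
-- since Σ B_k(x) t^k/k! = t e^{xt}/(e^t − 1) and Σ S_ℓ(b − 1) t^ℓ/ℓ! = (e^{bt} − 1)/(e^t − 1).
-- Multiplying by the three denominators leaves t e^{αβγyt} (e^{αβγt} − 1)², which does not
-- change under cyclic permutation of (a, b, c); and in a ℚ-algebra multiplication by
-- e^{xt} − 1 can be undone whenever x is invertible.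

open import Defs
open import Level using (Level)
open import Data.Nat using (ℕ; NonZero)
open import Data.Nat.Primality using (Prime)
open import Data.Rational using (ℚ)
open import Data.Rational.Properties using (+-*-rawRing)
open import Data.Product using (_×_; _,_)
open import Algebra.Bundles using (CommutativeRing)
open import Algebra.Morphism.Structures using (IsRingHomomorphism)

open import Data.Nat as ℕ using (zero; suc; _∸_; _<_; _≤_; _!)
import Data.Nat.Properties as ℕ
open import Data.Nat.Combinatorics using (_C_; nCk≡nC[n∸k]; nCn≡1; nC1≡n; k![n∸k]!∣n!)
open import Data.Nat.Combinatorics.Specification using (nCk≡n!/k![n-k]!)
open import Data.Nat.DivMod using (m/n*n≡m)
open import Data.Nat.Induction using (<-rec)
open import Data.Nat.ListAction using (sum)
import Data.Nat.Tactic.RingSolver as ℕ-Solver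
open import Data.Integer as ℤ using (+_)
import Data.Integer.Properties as ℤ
open import Data.Integer.Tactic.RingSolver using (solve-∀)
open import Data.Rational as ℚ using (_/_; toℚᵘ)
open import Data.Rational.Properties using (toℚᵘ-injective; toℚᵘ-fromℚᵘ; toℚᵘ-homo-*; toℚᵘ-homo-+)
open import Data.Rational.Unnormalised as ℚᵘ using (mkℚᵘ; *≡*)
import Data.Rational.Unnormalised.Properties as ℚᵘ
open import Data.Fin using (toℕ)
open import Data.List using (List; []; _∷_; _++_; map; upTo; applyUpTo; zipWith; concatMap)
import Data.List.Properties as List
open import Data.Product using (proj₂)
open import Algebra.Bundles using (CommutativeMonoid)
open import Relation.Binary.Bundles using (Setoid)
import Relation.Binary.Reasoning.Setoid as SetoidReasoning
open import Relation.Binary.PropositionalEquality as ≡ using (_≡_)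
open import Function using (_∘_)

private
  toℚᵘ-/ : ∀ i d → toℚᵘ (i / suc d) ℚᵘ.≃ mkℚᵘ i d
  toℚᵘ-/ i d = toℚᵘ-fromℚᵘ (mkℚᵘ i d)

ι-+ : ∀ m n → ι (m ℕ.+ n) ≡ ι m ℚ.+ ι n
ι-+ m n = toℚᵘ-injective (begin
  toℚᵘ (ι (m ℕ.+ n))              ≈⟨ toℚᵘ-/ (+ (m ℕ.+ n)) 0 ⟩
  mkℚᵘ (+ (m ℕ.+ n)) 0            ≈⟨ *≡* (≡.trans (≡.cong (ℤ._* + 1) (ℤ.pos-+ m n)) (cross (+ m) (+ n))) ⟩
  mkℚᵘ (+ m) 0 ℚᵘ.+ mkℚᵘ (+ n) 0  ≈⟨ ℚᵘ.+-cong (toℚᵘ-/ (+ m) 0) (toℚᵘ-/ (+ n) 0) ⟨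
  toℚᵘ (ι m) ℚᵘ.+ toℚᵘ (ι n)      ≈⟨ toℚᵘ-homo-+ (ι m) (ι n) ⟨
  toℚᵘ (ι m ℚ.+ ι n)              ∎)
  where
  open ℚᵘ.≃-Reasoning
  cross : ∀ x y → (x ℤ.+ y) ℤ.* + 1 ≡ (x ℤ.* + 1 ℤ.+ y ℤ.* + 1) ℤ.* + 1
  cross = solve-∀

/≡ι*1/ : ∀ a b .{{_ : NonZero b}} → (+ a) / b ≡ ι a ℚ.* ((+ 1) / b)
/≡ι*1/ a (suc d) = toℚᵘ-injective (begin
  toℚᵘ ((+ a) / suc d)                  ≈⟨ toℚᵘ-/ (+ a) d ⟩
  mkℚᵘ (+ a) d                          ≈⟨ *≡* (≡.cong₂ (λ x e → x ℤ.* + suc e) (≡.sym (ℤ.*-identityʳ (+ a))) (ℕ.+-identityʳ d)) ⟩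
  mkℚᵘ (+ a) 0 ℚᵘ.* mkℚᵘ (+ 1) d        ≈⟨ ℚᵘ.*-cong (toℚᵘ-/ (+ a) 0) (toℚᵘ-/ (+ 1) d) ⟨
  toℚᵘ (ι a) ℚᵘ.* toℚᵘ ((+ 1) / suc d)  ≈⟨ toℚᵘ-homo-* (ι a) ((+ 1) / suc d) ⟨
  toℚᵘ (ι a ℚ.* ((+ 1) / suc d))        ∎)
  where open ℚᵘ.≃-Reasoning

ι*1/≡1 : ∀ b .{{_ : NonZero b}} → ι b ℚ.* ((+ 1) / b) ≡ ℚ.1ℚ
ι*1/≡1 b@(suc d) = ≡.trans (≡.sym (/≡ι*1/ b b))
  (toℚᵘ-injective (ℚᵘ.≃-trans (toℚᵘ-/ (+ b) d) (*≡* (ℤ.*-comm (+ b) (+ 1)))))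

nCk*k!*[n∸k]!≡n! : ∀ {n k} → k ≤ n → (n C k) ℕ.* (k ! ℕ.* (n ∸ k) !) ≡ n !
nCk*k!*[n∸k]!≡n! {n} {k} k≤n = begin
  (n C k) ℕ.* (k ! ℕ.* (n ∸ k) !)                        ≡⟨ ≡.cong (ℕ._* (k ! ℕ.* (n ∸ k) !)) (nCk≡n!/k![n-k]! k≤n) ⟩
  (n ! ℕ./ (k ! ℕ.* (n ∸ k) !)) ℕ.* (k ! ℕ.* (n ∸ k) !)  ≡⟨ m/n*n≡m (k![n∸k]!∣n! k≤n) ⟩
  n !                                                    ∎
  where
  open ≡.≡-Reasoning
  instance
    _ = ℕ.m*n≢0 (k !) ((n ∸ k) !) {{k ℕ.!≢0}} {{(n ∸ k) ℕ.!≢0}}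

multinomial-factorisation : ∀ {n k l} → k ≤ n → l ≤ n ∸ k →
  ((n C k) ℕ.* ((n ∸ k) C l)) ℕ.* (k ! ℕ.* (l ! ℕ.* (n ∸ k ∸ l) !)) ≡ n !
multinomial-factorisation {n} {k} {l} k≤n l≤n∸k = begin
  ((n C k) ℕ.* ((n ∸ k) C l)) ℕ.* (k ! ℕ.* (l ! ℕ.* m !))  ≡⟨ regroup (n C k) ((n ∸ k) C l) (k !) (l !) (m !) ⟩
  (n C k) ℕ.* (k ! ℕ.* (((n ∸ k) C l) ℕ.* (l ! ℕ.* m !)))  ≡⟨ ≡.cong (λ t → (n C k) ℕ.* (k ! ℕ.* t)) (nCk*k!*[n∸k]!≡n! l≤n∸k) ⟩
  (n C k) ℕ.* (k ! ℕ.* (n ∸ k) !)                          ≡⟨ nCk*k!*[n∸k]!≡n! k≤n ⟩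
  n !                                                      ∎
  where
  open ≡.≡-Reasoning
  m = n ∸ k ∸ l
  regroup : ∀ a b x y z → (a ℕ.* b) ℕ.* (x ℕ.* (y ℕ.* z)) ≡ a ℕ.* (x ℕ.* (b ℕ.* (y ℕ.* z)))
  regroup = ℕ-Solver.solve-∀

nC[j+i]*[j+i]Cj≡nCj*[n∸j]Ci : ∀ n j i → j ℕ.+ i ≤ n → (n C (j ℕ.+ i)) ℕ.* ((j ℕ.+ i) C j) ≡ (n C j) ℕ.* ((n ∸ j) C i)
nC[j+i]*[j+i]Cj≡nCj*[n∸j]Ci n j i j+i≤n = ℕ.*-cancelʳ-≡ _ _ (j ! ℕ.* (i ! ℕ.* r !)) {{j!i!r!≢0}} (begin
  ((n C K) ℕ.* (K C j)) ℕ.* (j ! ℕ.* (i ! ℕ.* r !))              ≡⟨ regroup (n C K) (K C j) (j !) (i !) (r !) ⟩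
  (n C K) ℕ.* (((K C j) ℕ.* (j ! ℕ.* i !)) ℕ.* r !)              ≡⟨ ≡.cong (λ t → (n C K) ℕ.* (t ℕ.* r !)) K!≡ ⟩
  (n C K) ℕ.* (K ! ℕ.* r !)                                      ≡⟨ nCk*k!*[n∸k]!≡n! j+i≤n ⟩
  n !                                                            ≡⟨ multinomial-factorisation j≤n i≤n∸j ⟨
  ((n C j) ℕ.* ((n ∸ j) C i)) ℕ.* (j ! ℕ.* (i ! ℕ.* (n ∸ j ∸ i) !))
    ≡⟨ ≡.cong (λ t → ((n C j) ℕ.* ((n ∸ j) C i)) ℕ.* (j ! ℕ.* (i ! ℕ.* t !))) (ℕ.∸-+-assoc n j i) ⟩
  ((n C j) ℕ.* ((n ∸ j) C i)) ℕ.* (j ! ℕ.* (i ! ℕ.* r !))        ∎)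
  where
  open ≡.≡-Reasoning
  K = j ℕ.+ i
  r = n ∸ K
  j!i!r!≢0 = ℕ.m*n≢0 (j !) (i ! ℕ.* r !) {{j ℕ.!≢0}} {{ℕ.m*n≢0 (i !) (r !) {{i ℕ.!≢0}} {{r ℕ.!≢0}}}}
  j≤n = ℕ.m+n≤o⇒m≤o j j+i≤n
  i≤n∸j = ℕ.m+n≤o⇒m≤o∸n i (≡.subst (_≤ n) (ℕ.+-comm j i) j+i≤n)
  K!≡ : (K C j) ℕ.* (j ! ℕ.* i !) ≡ K !
  K!≡ = ≡.subst (λ t → (K C j) ℕ.* (j ! ℕ.* t !) ≡ K !) (ℕ.m+n∸m≡n j i) (nCk*k!*[n∸k]!≡n! (ℕ.m≤m+n j i))
  regroup : ∀ a b x y z → (a ℕ.* b) ℕ.* (x ℕ.* (y ℕ.* z)) ≡ a ℕ.* ((b ℕ.* (x ℕ.* y)) ℕ.* z)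
  regroup = ℕ-Solver.solve-∀

module FiniteSums {c ℓ : Level} (R : CommutativeRing c ℓ) where
  open CommutativeRing R
  open SetoidReasoning setoid
  open import Algebra.Properties.CommutativeSemigroup +-commutativeSemigroup using (interchange)

  ∑ : (ℕ → Carrier) → ℕ → Carrier
  ∑ f zero = 0#
  ∑ f (suc n) = ∑ f n + f n

  syntax ∑ (λ k → e) n = ∑[ k < n ] e

  ∑-cong : ∀ {f g} n → (∀ k → k < n → f k ≈ g k) → ∑ f n ≈ ∑ g n
  ∑-cong zero eq = refl
  ∑-cong (suc n) eq = +-cong (∑-cong n (λ k k<n → eq k (ℕ.m<n⇒m<1+n k<n))) (eq n ℕ.≤-refl)

  ∑-zero : ∀ {f} n → (∀ k → k < n → f k ≈ 0#) → ∑ f n ≈ 0#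
  ∑-zero n eq = trans (∑-cong n eq) (∑0 n)
    where
    ∑0 : ∀ n → ∑ (λ _ → 0#) n ≈ 0#
    ∑0 zero = refl
    ∑0 (suc n) = trans (+-identityʳ _) (∑0 n)

  ∑-+ : ∀ f g n → ∑[ k < n ] (f k + g k) ≈ ∑ f n + ∑ g n
  ∑-+ f g zero = sym (+-identityˡ 0#)
  ∑-+ f g (suc n) = trans (+-congʳ (∑-+ f g n)) (interchange _ _ _ _)

  ∑-distribˡ : ∀ a f n → a * ∑ f n ≈ ∑[ k < n ] (a * f k)
  ∑-distribˡ a f zero = zeroʳ a
  ∑-distribˡ a f (suc n) = trans (distribˡ a _ _) (+-congʳ (∑-distribˡ a f n))

  ∑-distribʳ : ∀ a f n → ∑ f n * a ≈ ∑[ k < n ] (f k * a)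
  ∑-distribʳ a f n = trans (*-comm _ a) (trans (∑-distribˡ a f n) (∑-cong n (λ k _ → *-comm a (f k))))

  ∑-head : ∀ f n → ∑ f (suc n) ≈ f 0 + ∑[ k < n ] f (suc k)
  ∑-head f zero = +-comm 0# (f 0)
  ∑-head f (suc n) = trans (+-congʳ (∑-head f n)) (+-assoc _ _ _)

  ∑-reverse : ∀ f n → ∑ f n ≈ ∑[ k < n ] f (n ∸ suc k)
  ∑-reverse f zero = refl
  ∑-reverse f (suc n) = begin
    ∑ f n + f n                        ≈⟨ +-congʳ (∑-reverse f n) ⟩
    ∑[ k < n ] f (n ∸ suc k) + f n     ≈⟨ +-comm _ _ ⟩
    f n + ∑[ k < n ] f (n ∸ suc k)     ≈⟨ ∑-head (λ k → f (n ∸ k)) n ⟨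
    ∑[ k < suc n ] f (n ∸ k)           ∎

  ∑-triangle : ∀ (F : ℕ → ℕ → Carrier) n →
    ∑[ k < suc n ] ∑[ j < suc k ] F j k ≈ ∑[ j < suc n ] ∑[ i < suc (n ∸ j) ] F j (j ℕ.+ i)
  ∑-triangle F zero = refl
  ∑-triangle F (suc n) = begin
    ∑[ k < suc n ] ∑[ j < suc k ] F j k + (∑[ j < suc n ] F j (suc n) + F (suc n) (suc n))
      ≈⟨ +-congʳ (∑-triangle F n) ⟩
    rows n + (∑[ j < suc n ] F j (suc n) + F (suc n) (suc n))
      ≈⟨ +-assoc _ _ _ ⟨
    (rows n + ∑[ j < suc n ] F j (suc n)) + F (suc n) (suc n)
      ≈⟨ +-cong (∑-+ _ _ (suc n)) (lastRow (n ∸ n) (ℕ.n∸n≡0 n)) ⟨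
    ∑[ j < suc n ] (row j (n ∸ j) + F j (suc n)) + row (suc n) (n ∸ n)
      ≈⟨ +-congʳ (∑-cong (suc n) extendRow) ⟩
    rows (suc n) ∎
    where
    row : ℕ → ℕ → Carrier
    row j m = ∑[ i < suc m ] F j (j ℕ.+ i)
    rows : ℕ → Carrier
    rows n = ∑[ j < suc n ] row j (n ∸ j)
    lastRow : ∀ m → m ≡ 0 → row (suc n) m ≈ F (suc n) (suc n)
    lastRow zero ≡.refl = trans (+-identityˡ _) (reflexive (≡.cong (F (suc n)) (ℕ.+-identityʳ (suc n))))
    extendRow : ∀ j → j < suc n → row j (n ∸ j) + F j (suc n) ≈ row j (suc n ∸ j)
    extendRow j j<1+n with j≤n ← ℕ.m<1+n⇒m≤n j<1+n
      rewrite ℕ.+-∸-assoc 1 j≤n =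
      +-congˡ (reflexive (≡.cong (F j) (≡.sym (≡.trans (ℕ.+-suc j (n ∸ j)) (≡.cong suc (ℕ.m+[n∸m]≡n j≤n))))))

module BinomialConvolution {c ℓ : Level} (R : CommutativeRing c ℓ) where
  open CommutativeRing R
  open FiniteSums R
  open import Algebra.Definitions _≈_ using (RightInvertible)
  open import Algebra.Properties.CommutativeSemiring.Exp commutativeSemiring using (_^_; ^-congˡ; ^-homo-*; ^-distrib-*)
  open import Algebra.Properties.Semiring.Mult semiring
    using (×-homo-1; ×-homo-+; ×1-homo-*; ×-assoc-*; ×-congʳ) renaming (_×_ to _·_)
  import Algebra.Properties.Semiring.Sum semiring as FinSum
  import Algebra.Properties.CommutativeSemiring.Binomial commutativeSemiring as Binomial
  open import Algebra.Properties.Group +-group using (∙-cancelˡ; ∙-cancelʳ)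
  import Algebra.Solver.CommutativeMonoid *-commutativeMonoid as *-Solver

  ν : ℕ → Carrier
  ν n = n · 1#

  ν-1 : ν 1 ≈ 1#
  ν-1 = ×-homo-1 1#

  ν-+ : ∀ m n → ν (m ℕ.+ n) ≈ ν m + ν n
  ν-+ = ×-homo-+ 1#

  ν-* : ∀ m n → ν (m ℕ.* n) ≈ ν m * ν n
  ν-* = ×1-homo-*

  ·≈ν* : ∀ n x → n · x ≈ ν n * x
  ·≈ν* n x = sym (trans (×-assoc-* n 1# x) (×-congʳ n (*-identityˡ x)))

  Seq : Set c
  Seq = ℕ → Carrier

  infix 4 _≋_
  _≋_ : Seq → Seq → Set ℓ
  f ≋ g = ∀ n → f n ≈ g n

  ≋-setoid : Setoid c ℓ
  ≋-setoid = record
    { Carrier = Seq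
    ; _≈_ = _≋_
    ; isEquivalence = record
      { refl = λ _ → refl
      ; sym = λ f≋g n → sym (f≋g n)
      ; trans = λ f≋g g≋h n → trans (f≋g n) (g≋h n)
      }
    }

  open Setoid ≋-setoid public using () renaming (refl to ≋-refl; sym to ≋-sym; trans to ≋-trans)
  module ≋-Reasoning = SetoidReasoning ≋-setoid

  infixl 6 _+ₛ_
  _+ₛ_ : Seq → Seq → Seq
  (f +ₛ g) n = f n + g n

  infixl 6 _+ₛ-cong_
  _+ₛ-cong_ : ∀ {f f′ g g′} → f ≋ f′ → g ≋ g′ → f +ₛ g ≋ f′ +ₛ g′
  (f≋f′ +ₛ-cong g≋g′) n = +-cong (f≋f′ n) (g≋g′ n)

  infixr 7 _*ₗ_
  _*ₗ_ : Carrier → Seq → Seq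
  (a *ₗ f) n = a * f n

  *ₗ-congˡ : ∀ a {f g} → f ≋ g → a *ₗ f ≋ a *ₗ g
  *ₗ-congˡ a f≋g n = *-congˡ (f≋g n)

  *ₗ-assoc : ∀ a b f → a *ₗ (b *ₗ f) ≋ (a * b) *ₗ f
  *ₗ-assoc a b f n = sym (*-assoc a b (f n))

  infixl 7 _⊛_
  _⊛_ : Seq → Seq → Seq
  (f ⊛ g) n = ∑[ k < suc n ] (ν (n C k) * (f k * g (n ∸ k)))

  ⊛-cong : ∀ {f f′ g g′} → f ≋ f′ → g ≋ g′ → f ⊛ g ≋ f′ ⊛ g′
  ⊛-cong f≋f′ g≋g′ n = ∑-cong (suc n) (λ k _ → *-congˡ (*-cong (f≋f′ k) (g≋g′ (n ∸ k))))

  ⊛-comm : ∀ f g → f ⊛ g ≋ g ⊛ f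
  ⊛-comm f g n = trans (∑-reverse _ (suc n)) (∑-cong (suc n) reflect)
    where
    reflect : ∀ k → k < suc n → ν (n C (n ∸ k)) * (f (n ∸ k) * g (n ∸ (n ∸ k))) ≈ ν (n C k) * (g k * f (n ∸ k))
    reflect k k<1+n = *-cong (reflexive (≡.cong ν (≡.sym (nCk≡nC[n∸k] k≤n))))
                             (trans (*-congˡ (reflexive (≡.cong g (ℕ.m∸[m∸n]≡n k≤n)))) (*-comm _ _))
      where k≤n = ℕ.m<1+n⇒m≤n k<1+n

  ν-binomial-product : ∀ n j i → j ℕ.+ i ≤ n →
    ν (n C (j ℕ.+ i)) * ν ((j ℕ.+ i) C j) ≈ ν (n C j) * ν ((n ∸ j) C i)
  ν-binomial-product n j i j+i≤n = begin
    ν (n C (j ℕ.+ i)) * ν ((j ℕ.+ i) C j)    ≈⟨ ν-* (n C (j ℕ.+ i)) ((j ℕ.+ i) C j) ⟨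
    ν ((n C (j ℕ.+ i)) ℕ.* ((j ℕ.+ i) C j))  ≡⟨ ≡.cong ν (nC[j+i]*[j+i]Cj≡nCj*[n∸j]Ci n j i j+i≤n) ⟩
    ν ((n C j) ℕ.* ((n ∸ j) C i))            ≈⟨ ν-* (n C j) ((n ∸ j) C i) ⟩
    ν (n C j) * ν ((n ∸ j) C i)              ∎
    where open SetoidReasoning setoid

  ⊛-assoc : ∀ f g h → (f ⊛ g) ⊛ h ≋ f ⊛ (g ⊛ h)
  ⊛-assoc f g h n = begin
    ((f ⊛ g) ⊛ h) n
      ≈⟨ ∑-cong (suc n) (λ k _ → trans (*-congˡ (∑-distribʳ _ _ (suc k))) (∑-distribˡ _ _ (suc k))) ⟩
    ∑[ k < suc n ] ∑[ j < suc k ] F j k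
      ≈⟨ ∑-triangle F n ⟩
    ∑[ j < suc n ] ∑[ i < suc (n ∸ j) ] F j (j ℕ.+ i)
      ≈⟨ ∑-cong (suc n) (λ j j<1+n → ∑-cong (suc (n ∸ j)) (λ i i<1+n∸j → reindex j i (j+i≤n j<1+n i<1+n∸j))) ⟩
    ∑[ j < suc n ] ∑[ i < suc (n ∸ j) ] (ν (n C j) * (f j * (ν ((n ∸ j) C i) * (g i * h (n ∸ j ∸ i)))))
      ≈⟨ ∑-cong (suc n) (λ j _ → trans (*-congˡ (∑-distribˡ _ _ (suc (n ∸ j)))) (∑-distribˡ _ _ (suc (n ∸ j)))) ⟨
    (f ⊛ (g ⊛ h)) n ∎
    where
    open SetoidReasoning setoid
    F : ℕ → ℕ → Carrier
    F j k = ν (n C k) * ((ν (k C j) * (f j * g (k ∸ j))) * h (n ∸ k))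
    j+i≤n : ∀ {j i} → j < suc n → i < suc (n ∸ j) → j ℕ.+ i ≤ n
    j+i≤n {j} j<1+n i<1+n∸j =
      ≡.subst (j ℕ.+ _ ≤_) (ℕ.m+[n∸m]≡n (ℕ.m<1+n⇒m≤n j<1+n)) (ℕ.+-monoʳ-≤ j (ℕ.m<1+n⇒m≤n i<1+n∸j))
    reindex : ∀ j i → j ℕ.+ i ≤ n → F j (j ℕ.+ i) ≈ ν (n C j) * (f j * (ν ((n ∸ j) C i) * (g i * h (n ∸ j ∸ i))))
    reindex j i j+i≤n = begin
      ν (n C (j ℕ.+ i)) * ((ν ((j ℕ.+ i) C j) * (f j * g (j ℕ.+ i ∸ j))) * h (n ∸ (j ℕ.+ i)))
        ≈⟨ *-congˡ (*-cong (*-congˡ (*-congˡ (reflexive (≡.cong g (ℕ.m+n∸m≡n j i)))))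
                           (reflexive (≡.cong h (≡.sym (ℕ.∸-+-assoc n j i))))) ⟩
      ν (n C (j ℕ.+ i)) * ((ν ((j ℕ.+ i) C j) * (f j * g i)) * h (n ∸ j ∸ i))
        ≈⟨ gather _ _ _ _ _ ⟩
      (ν (n C (j ℕ.+ i)) * ν ((j ℕ.+ i) C j)) * (f j * (g i * h (n ∸ j ∸ i)))
        ≈⟨ *-congʳ (ν-binomial-product n j i j+i≤n) ⟩
      (ν (n C j) * ν ((n ∸ j) C i)) * (f j * (g i * h (n ∸ j ∸ i)))
        ≈⟨ scatter _ _ _ _ _ ⟩
      ν (n C j) * (f j * (ν ((n ∸ j) C i) * (g i * h (n ∸ j ∸ i)))) ∎
      where
      open *-Solver
      gather : ∀ a b x y z → a * ((b * (x * y)) * z) ≈ (a * b) * (x * (y * z))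
      gather = solve 5 (λ a b x y z → a ⊕ ((b ⊕ (x ⊕ y)) ⊕ z) ⊜ (a ⊕ b) ⊕ (x ⊕ (y ⊕ z))) refl
      scatter : ∀ a b x y z → (a * b) * (x * (y * z)) ≈ a * (x * (b * (y * z)))
      scatter = solve 5 (λ a b x y z → (a ⊕ b) ⊕ (x ⊕ (y ⊕ z)) ⊜ a ⊕ (x ⊕ (b ⊕ (y ⊕ z)))) refl

  δ : Seq
  δ zero = 1#
  δ (suc n) = 0#

  ⊛-identityʳ : ∀ f → f ⊛ δ ≋ f
  ⊛-identityʳ f n = begin
    ∑[ k < n ] (ν (n C k) * (f k * δ (n ∸ k))) + ν (n C n) * (f n * δ (n ∸ n))
      ≈⟨ +-cong (∑-zero n (λ k k<n → δ-pos (n ∸ k) (ℕ.m<n⇒0<n∸m k<n)))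
                (*-cong (trans (reflexive (≡.cong ν (nCn≡1 n))) ν-1) (*-congˡ (reflexive (≡.cong δ (ℕ.n∸n≡0 n))))) ⟩
    0# + 1# * (f n * 1#)
      ≈⟨ trans (+-identityˡ _) (trans (*-identityˡ _) (*-identityʳ _)) ⟩
    f n ∎
    where
    open SetoidReasoning setoid
    δ-pos : ∀ m → 0 < m → ∀ {a b} → a * (b * δ m) ≈ 0#
    δ-pos (suc m) _ = trans (*-congˡ (zeroʳ _)) (zeroʳ _)

  ⊛-commutativeMonoid : CommutativeMonoid c ℓ
  ⊛-commutativeMonoid = record
    { Carrier = Seq
    ; _≈_ = _≋_
    ; _∙_ = _⊛_
    ; ε = δ
    ; isCommutativeMonoid = record
      { isMonoid = record
        { isSemigroup = record
          { isMagma = record { isEquivalence = Setoid.isEquivalence ≋-setoid ; ∙-cong = ⊛-cong }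
          ; assoc = ⊛-assoc
          }
        ; identity = (λ f n → trans (⊛-comm δ f n) (⊛-identityʳ f n)) , ⊛-identityʳ
        }
      ; comm = ⊛-comm
      }
    }

  ⊛-distribʳ : ∀ f g h → (f +ₛ g) ⊛ h ≋ f ⊛ h +ₛ g ⊛ h
  ⊛-distribʳ f g h n = trans (∑-cong (suc n) (λ k _ → trans (*-congˡ (distribʳ _ _ _)) (distribˡ _ _ _))) (∑-+ _ _ (suc n))

  ⊛-zeroˡ : ∀ h → (λ _ → 0#) ⊛ h ≋ (λ _ → 0#)
  ⊛-zeroˡ h n = ∑-zero (suc n) (λ k _ → trans (*-congˡ (zeroˡ _)) (zeroʳ _))

  *ₗ-⊛ : ∀ a f g → (a *ₗ f) ⊛ g ≋ a *ₗ (f ⊛ g)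
  *ₗ-⊛ a f g n = trans (∑-cong (suc n) (λ k _ → pull _ _ _ _)) (sym (∑-distribˡ a _ (suc n)))
    where
    open *-Solver
    pull : ∀ b a x y → b * ((a * x) * y) ≈ a * (b * (x * y))
    pull = solve 4 (λ b a x y → b ⊕ ((a ⊕ x) ⊕ y) ⊜ a ⊕ (b ⊕ (x ⊕ y))) refl

  -- the exponential generating functions e^{xt} and e^{xt} − 1
  exp expm1 : Carrier → Seq
  exp x n = x ^ n
  expm1 x zero = 0#
  expm1 x (suc n) = x ^ suc n

  exp-cong : ∀ {x y} → x ≈ y → exp x ≋ exp y
  exp-cong x≈y n = ^-congˡ n x≈y

  expm1-cong : ∀ {x y} → x ≈ y → expm1 x ≋ expm1 y
  expm1-cong x≈y zero = refl
  expm1-cong x≈y (suc n) = ^-congˡ (suc n) x≈y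

  exp≋expm1+δ : ∀ x → exp x ≋ expm1 x +ₛ δ
  exp≋expm1+δ x zero = sym (+-identityˡ 1#)
  exp≋expm1+δ x (suc n) = sym (+-identityʳ _)

  exp-⊛ : ∀ x y → exp x ⊛ exp y ≋ exp (x + y)
  exp-⊛ x y n = sym (begin
    (x + y) ^ n                                       ≈⟨ Binomial.theorem n x y ⟩
    Binomial.binomialExpansion x y n                  ≈⟨ sum≈∑ (suc n) (λ k → (n C k) · (x ^ k * y ^ (n ∸ k))) ⟩
    ∑[ k < suc n ] ((n C k) · (x ^ k * y ^ (n ∸ k)))  ≈⟨ ∑-cong (suc n) (λ k _ → ·≈ν* (n C k) _) ⟩
    (exp x ⊛ exp y) n                                 ∎)
    where
    open SetoidReasoning setoid
    sum≈∑ : ∀ n (t : ℕ → Carrier) → FinSum.sum {n} (λ k → t (toℕ k)) ≈ ∑ t n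
    sum≈∑ zero t = refl
    sum≈∑ (suc n) t = trans (+-congˡ (sum≈∑ n (λ k → t (suc k)))) (sym (∑-head t n))

  expm1-+ : ∀ x y → expm1 (x + y) ≋ expm1 x +ₛ exp x ⊛ expm1 y
  expm1-+ x y n = ∙-cancelʳ (δ n) _ _ (expm1+δ n)
    where
    open ≋-Reasoning
    open import Algebra.Properties.CommutativeSemigroup +-commutativeSemigroup using (x∙yz≈yx∙z)
    expm1+δ : expm1 (x + y) +ₛ δ ≋ (expm1 x +ₛ exp x ⊛ expm1 y) +ₛ δ
    expm1+δ = begin
      expm1 (x + y) +ₛ δ                 ≈⟨ exp≋expm1+δ (x + y) ⟨
      exp (x + y)                        ≈⟨ exp-⊛ x y ⟨
      exp x ⊛ exp y                      ≈⟨ ⊛-cong (≋-refl {exp x}) (exp≋expm1+δ y) ⟩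
      exp x ⊛ (expm1 y +ₛ δ)             ≈⟨ ⊛-comm (exp x) (expm1 y +ₛ δ) ⟩
      (expm1 y +ₛ δ) ⊛ exp x             ≈⟨ ⊛-distribʳ (expm1 y) δ (exp x) ⟩
      expm1 y ⊛ exp x +ₛ δ ⊛ exp x
        ≈⟨ ⊛-comm (expm1 y) (exp x) +ₛ-cong ≋-trans (⊛-comm δ (exp x)) (⊛-identityʳ (exp x)) ⟩
      exp x ⊛ expm1 y +ₛ exp x           ≈⟨ ≋-refl +ₛ-cong exp≋expm1+δ x ⟩
      exp x ⊛ expm1 y +ₛ (expm1 x +ₛ δ)  ≈⟨ (λ _ → x∙yz≈yx∙z _ _ _) ⟩
      (expm1 x +ₛ exp x ⊛ expm1 y) +ₛ δ  ∎

  ∑ₛ : (ℕ → Seq) → ℕ → Seq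
  ∑ₛ G b n = ∑[ i < b ] G i n

  geometric-⊛-expm1 : ∀ s b → ∑ₛ (λ i → exp (ν i * s)) b ⊛ expm1 s ≋ expm1 (ν b * s)
  geometric-⊛-expm1 s zero = ≋-trans (⊛-zeroˡ (expm1 s)) 0≋expm1[0*s]
    where
    0≋expm1[0*s] : (λ _ → 0#) ≋ expm1 (0# * s)
    0≋expm1[0*s] zero = refl
    0≋expm1[0*s] (suc n) = sym (trans (*-congʳ (zeroˡ s)) (zeroˡ _))
  geometric-⊛-expm1 s (suc b) = begin
    (∑ₛ G b +ₛ G b) ⊛ expm1 s                    ≈⟨ ⊛-distribʳ (∑ₛ G b) (G b) (expm1 s) ⟩
    ∑ₛ G b ⊛ expm1 s +ₛ G b ⊛ expm1 s            ≈⟨ geometric-⊛-expm1 s b +ₛ-cong ≋-refl ⟩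
    expm1 (ν b * s) +ₛ exp (ν b * s) ⊛ expm1 s   ≈⟨ expm1-+ (ν b * s) s ⟨
    expm1 (ν b * s + s)                          ≈⟨ expm1-cong νb*s+s≈ν[1+b]*s ⟩
    expm1 (ν (suc b) * s)                        ∎
    where
    open ≋-Reasoning
    G : ℕ → Seq
    G i = exp (ν i * s)
    νb*s+s≈ν[1+b]*s : ν b * s + s ≈ ν (suc b) * s
    νb*s+s≈ν[1+b]*s = trans (+-congˡ (sym (*-identityˡ s))) (trans (sym (distribʳ s (ν b) 1#)) (*-congʳ (+-comm (ν b) 1#)))

  -- the generating function f(st)
  rescale : Carrier → Seq → Seq
  rescale s f n = s ^ n * f n

  rescale-cong : ∀ s {f g} → f ≋ g → rescale s f ≋ rescale s g
  rescale-cong s f≋g n = *-congˡ (f≋g n)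

  rescale-⊛ : ∀ s f g → rescale s (f ⊛ g) ≋ rescale s f ⊛ rescale s g
  rescale-⊛ s f g n = trans (∑-distribˡ (s ^ n) _ (suc n)) (∑-cong (suc n) (λ k k<1+n → sym (begin
    ν (n C k) * ((s ^ k * f k) * (s ^ (n ∸ k) * g (n ∸ k)))  ≈⟨ shuffle _ _ _ _ _ ⟩
    (s ^ k * s ^ (n ∸ k)) * (ν (n C k) * (f k * g (n ∸ k)))  ≈⟨ *-congʳ (^-homo-* s k (n ∸ k)) ⟨
    s ^ (k ℕ.+ (n ∸ k)) * (ν (n C k) * (f k * g (n ∸ k)))
      ≡⟨ ≡.cong (λ e → s ^ e * (ν (n C k) * (f k * g (n ∸ k)))) (ℕ.m+[n∸m]≡n (ℕ.m<1+n⇒m≤n k<1+n)) ⟩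
    s ^ n * (ν (n C k) * (f k * g (n ∸ k)))                  ∎)))
    where
    open SetoidReasoning setoid
    open *-Solver
    shuffle : ∀ c a x b y → c * ((a * x) * (b * y)) ≈ (a * b) * (c * (x * y))
    shuffle = solve 5 (λ c a x b y → c ⊕ ((a ⊕ x) ⊕ (b ⊕ y)) ⊜ (a ⊕ b) ⊕ (c ⊕ (x ⊕ y))) refl

  rescale-exp : ∀ s x → rescale s (exp x) ≋ exp (s * x)
  rescale-exp s x n = sym (^-distrib-* s x n)

  rescale-expm1 : ∀ s x → rescale s (expm1 x) ≋ expm1 (s * x)
  rescale-expm1 s x zero = zeroʳ _
  rescale-expm1 s x (suc n) = sym (^-distrib-* s x (suc n))

  invertible-* : ∀ {a b} → RightInvertible 1# _*_ a → RightInvertible 1# _*_ b → RightInvertible 1# _*_ (a * b)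
  invertible-* (u , a*u≈1) (v , b*v≈1) = u * v , trans (interchange _ _ _ _) (trans (*-cong a*u≈1 b*v≈1) (*-identityˡ 1#))
    where open import Algebra.Properties.CommutativeSemigroup *-commutativeSemigroup using (interchange)

  invertible-cancelˡ : ∀ {a p q} → RightInvertible 1# _*_ a → a * p ≈ a * q → p ≈ q
  invertible-cancelˡ {a} {p} {q} (u , a*u≈1) ap≈aq = begin
    p            ≈⟨ u*[a*r]≈r p ⟨
    u * (a * p)  ≈⟨ *-congˡ ap≈aq ⟩
    u * (a * q)  ≈⟨ u*[a*r]≈r q ⟩
    q            ∎
    where
    open SetoidReasoning setoid
    u*[a*r]≈r : ∀ r → u * (a * r) ≈ r
    u*[a*r]≈r r = trans (sym (*-assoc u a r)) (trans (*-congʳ (trans (*-comm u a) a*u≈1)) (*-identityˡ r))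

  -- Index n + 1 of f ⊛ expm1 x is (n + 1) x · f n plus a combination of f 0, …, f (n − 1).
  ⊛-expm1-cancelʳ : ∀ x {f g} → (∀ n → RightInvertible 1# _*_ (ν (suc n) * x)) → f ⊛ expm1 x ≋ g ⊛ expm1 x → f ≋ g
  ⊛-expm1-cancelʳ x {f} {g} invertible f⊛e≋g⊛e = <-rec (λ n → f n ≈ g n) step
    where
    open SetoidReasoning setoid
    lower : Seq → ℕ → Carrier
    lower h n = ∑[ k < n ] (ν (suc n C k) * (h k * expm1 x (suc n ∸ k)))
    ⊛-expm1-suc : ∀ h n → (h ⊛ expm1 x) (suc n) ≈ lower h n + (ν (suc n) * x) * h n
    ⊛-expm1-suc h n = begin
      (lower h n + ν (suc n C n) * (h n * expm1 x (suc n ∸ n))) + ν (suc n C suc n) * (h (suc n) * expm1 x (n ∸ n))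
        ≈⟨ +-congˡ (trans (*-congˡ (trans (*-congˡ (reflexive (≡.cong (expm1 x) (ℕ.n∸n≡0 n)))) (zeroʳ _))) (zeroʳ _)) ⟩
      (lower h n + ν (suc n C n) * (h n * expm1 x (suc n ∸ n))) + 0#
        ≈⟨ +-identityʳ _ ⟩
      lower h n + ν (suc n C n) * (h n * expm1 x (suc n ∸ n))
        ≈⟨ +-congˡ (*-cong (reflexive (≡.cong ν [1+n]Cn≡1+n))
                           (*-congˡ (trans (reflexive (≡.cong (expm1 x) (ℕ.m+n∸n≡m 1 n))) (*-identityʳ x)))) ⟩
      lower h n + ν (suc n) * (h n * x)
        ≈⟨ +-congˡ (trans (*-congˡ (*-comm (h n) x)) (sym (*-assoc _ x (h n)))) ⟩
      lower h n + (ν (suc n) * x) * h n ∎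
      where
      [1+n]Cn≡1+n : suc n C n ≡ suc n
      [1+n]Cn≡1+n = ≡.trans (nCk≡nC[n∸k] (ℕ.n≤1+n n)) (≡.trans (≡.cong (suc n C_) (ℕ.m+n∸n≡m 1 n)) (nC1≡n (suc n)))
    step : ∀ n → (∀ {k} → k < n → f k ≈ g k) → f n ≈ g n
    step n f≈g-below = invertible-cancelˡ (invertible n) (∙-cancelˡ (lower f n) _ _ (begin
      lower f n + (ν (suc n) * x) * f n  ≈⟨ ⊛-expm1-suc f n ⟨
      (f ⊛ expm1 x) (suc n)              ≈⟨ f⊛e≋g⊛e (suc n) ⟩
      (g ⊛ expm1 x) (suc n)              ≈⟨ ⊛-expm1-suc g n ⟩
      lower g n + (ν (suc n) * x) * g n  ≈⟨ +-congʳ (∑-cong n (λ k k<n → *-congˡ (*-congʳ (sym (f≈g-below k<n))))) ⟩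
      lower f n + (ν (suc n) * x) * g n  ∎))

module ℚ-Algebra {c ℓ : Level} (R : CommutativeRing c ℓ) (φ : ℚ → CommutativeRing.Carrier R)
                 (φ-hom : IsRingHomomorphism +-*-rawRing (CommutativeRing.rawRing R) φ) where
  open CommutativeRing R
  open IsRingHomomorphism φ-hom using (+-homo; *-homo; 0#-homo; 1#-homo; -‿homo)
  open FiniteSums R
  open BinomialConvolution R
  open import Algebra.Definitions _≈_ using (RightInvertible)
  open import Algebra.Properties.CommutativeSemiring.Exp commutativeSemiring using (_^_; ^-homo-*; ^-distrib-*)
  import Algebra.Solver.CommutativeMonoid *-commutativeMonoid as *-Solver
  import Algebra.Solver.CommutativeMonoid ⊛-commutativeMonoid as ⊛-Solver

  φ∘ι≈ν : ∀ n → φ (ι n) ≈ ν n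
  φ∘ι≈ν zero = 0#-homo
  φ∘ι≈ν (suc n) = trans (reflexive (≡.cong φ (ι-+ 1 n))) (trans (+-homo (ι 1) (ι n)) (+-cong 1#-homo (φ∘ι≈ν n)))

  ν-invertible : ∀ m .{{_ : NonZero m}} → RightInvertible 1# _*_ (ν m)
  ν-invertible m = φ ((+ 1) / m) , (begin
    ν m * φ ((+ 1) / m)      ≈⟨ *-congʳ (φ∘ι≈ν m) ⟨
    φ (ι m) * φ ((+ 1) / m)  ≈⟨ *-homo (ι m) ((+ 1) / m) ⟨
    φ (ι m ℚ.* ((+ 1) / m))  ≡⟨ ≡.cong φ (ι*1/≡1 m) ⟩
    φ ℚ.1ℚ                   ≈⟨ 1#-homo ⟩
    1#                       ∎)
    where open SetoidReasoning setoid

  ^R≈^ : ∀ x n → _^R_ R φ x n ≈ x ^ n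
  ^R≈^ x zero = refl
  ^R≈^ x (suc n) = *-congˡ (^R≈^ x n)

  φ-ι^ℚ : ∀ x e → φ (ι x ^ℚ e) ≈ ν x ^ e
  φ-ι^ℚ x zero = 1#-homo
  φ-ι^ℚ x (suc e) = trans (*-homo (ι x) (ι x ^ℚ e)) (*-cong (φ∘ι≈ν x) (φ-ι^ℚ x e))

  φ-*⁸ : ∀ q₁ q₂ q₃ q₄ q₅ q₆ q₇ q₈ → φ (q₁ ℚ.* q₂ ℚ.* q₃ ℚ.* q₄ ℚ.* q₅ ℚ.* q₆ ℚ.* q₇ ℚ.* q₈)
         ≈ φ q₁ * φ q₂ * φ q₃ * φ q₄ * φ q₅ * φ q₆ * φ q₇ * φ q₈
  φ-*⁸ q₁ q₂ q₃ q₄ q₅ q₆ q₇ q₈ =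
    trans (*-homo _ q₈) (*-congʳ (trans (*-homo _ q₇) (*-congʳ (trans (*-homo _ q₆) (*-congʳ (trans (*-homo _ q₅)
      (*-congʳ (trans (*-homo _ q₄) (*-congʳ (trans (*-homo _ q₃) (*-congʳ (*-homo q₁ q₂))))))))))))

  φ-Σℚ : ∀ xs → φ (Σℚ xs) ≈ ΣR R φ (map φ xs)
  φ-Σℚ [] = 0#-homo
  φ-Σℚ (x ∷ xs) = trans (+-homo x (Σℚ xs)) (+-congˡ (φ-Σℚ xs))

  ΣR-applyUpTo : ∀ f n → ΣR R φ (applyUpTo f n) ≈ ∑ f n
  ΣR-applyUpTo f zero = refl
  ΣR-applyUpTo f (suc n) = trans (+-congˡ (ΣR-applyUpTo (λ k → f (suc k)) n)) (sym (∑-head f n))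

  ΣR-map-upTo : ∀ f n → ΣR R φ (map f (upTo n)) ≈ ∑ f n
  ΣR-map-upTo f n = trans (reflexive (≡.cong (ΣR R φ) (List.map-upTo f n))) (ΣR-applyUpTo f n)

  ΣR-++ : ∀ xs ys → ΣR R φ (xs ++ ys) ≈ ΣR R φ xs + ΣR R φ ys
  ΣR-++ [] ys = sym (+-identityˡ _)
  ΣR-++ (x ∷ xs) ys = trans (+-congˡ (ΣR-++ xs ys)) (sym (+-assoc _ _ _))

  ΣR-map-concatMap : ∀ {A B : Set} (t : B → Carrier) (g : A → List B) xs →
    ΣR R φ (map t (concatMap g xs)) ≈ ΣR R φ (map (λ x → ΣR R φ (map t (g x))) xs)
  ΣR-map-concatMap t g [] = refl
  ΣR-map-concatMap t g (x ∷ xs) = trans (reflexive (≡.cong (ΣR R φ) (List.map-++ t (g x) (concatMap g xs))))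
    (trans (ΣR-++ (map t (g x)) _) (+-congˡ (ΣR-map-concatMap t g xs)))

  ΣR-triples : ∀ (t : ℕ × ℕ × ℕ → Carrier) n →
    ΣR R φ (map t (triples n)) ≈ ∑[ k < suc n ] ∑[ l < suc (n ∸ k) ] t (k , l , n ∸ k ∸ l)
  ΣR-triples t n = begin
    ΣR R φ (map t (triples n))                                   ≈⟨ ΣR-map-concatMap t row (upTo (suc n)) ⟩
    ΣR R φ (map (λ k → ΣR R φ (map t (row k))) (upTo (suc n)))   ≈⟨ ΣR-map-upTo _ (suc n) ⟩
    ∑[ k < suc n ] ΣR R φ (map t (row k))
      ≈⟨ ∑-cong (suc n) (λ k _ → trans (reflexive (≡.cong (ΣR R φ) (≡.sym (List.map-∘ (upTo (suc (n ∸ k)))))))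
                                        (ΣR-map-upTo _ (suc (n ∸ k)))) ⟩
    ∑[ k < suc n ] ∑[ l < suc (n ∸ k) ] t (k , l , n ∸ k ∸ l)    ∎
    where
    open SetoidReasoning setoid
    row : ℕ → List (ℕ × ℕ × ℕ)
    row k = map (λ l → (k , l , n ∸ k ∸ l)) (upTo (suc (n ∸ k)))

  φ-multinom : ∀ n k l → k ≤ n → l ≤ n ∸ k → φ (multinom n k l (n ∸ k ∸ l)) ≈ ν (n C k) * ν ((n ∸ k) C l)
  φ-multinom n k l k≤n l≤n∸k = begin
    φ ((+ (n !)) / d)                  ≡⟨ ≡.cong φ (/≡ι*1/ (n !) d) ⟩
    φ (ι (n !) ℚ.* ((+ 1) / d))        ≈⟨ trans (*-homo _ _) (*-congʳ (φ∘ι≈ν (n !))) ⟩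
    ν (n !) * φ ((+ 1) / d)            ≡⟨ ≡.cong (λ e → ν e * φ ((+ 1) / d)) (multinomial-factorisation k≤n l≤n∸k) ⟨
    ν (C₁C₂ ℕ.* d) * φ ((+ 1) / d)     ≈⟨ *-congʳ (ν-* C₁C₂ d) ⟩
    (ν C₁C₂ * ν d) * φ ((+ 1) / d)     ≈⟨ *-assoc _ _ _ ⟩
    ν C₁C₂ * (ν d * φ ((+ 1) / d))     ≈⟨ *-congˡ (proj₂ (ν-invertible d)) ⟩
    ν C₁C₂ * 1#                        ≈⟨ trans (*-identityʳ _) (ν-* (n C k) ((n ∸ k) C l)) ⟩
    ν (n C k) * ν ((n ∸ k) C l)        ∎
    where
    open SetoidReasoning setoid
    m = n ∸ k ∸ l
    C₁C₂ = (n C k) ℕ.* ((n ∸ k) C l)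
    d = k ! ℕ.* (l ! ℕ.* m !)
    instance
      _ = k ℕ.!≢0
      _ = l ℕ.!≢0
      _ = m ℕ.!≢0
      _ = ℕ.m*n≢0 (l !) (m !)
      _ = ℕ.m*n≢0 (k !) (l ! ℕ.* m !)

  B : Seq
  B j = φ (bernoulli j)

  -- the generating function t
  τ : Seq
  τ zero = 0#
  τ (suc zero) = 1#
  τ (suc (suc n)) = 0#

  bernList≡applyUpTo : ∀ n → bernList n ≡ applyUpTo bernoulli n
  bernList≡applyUpTo zero = ≡.refl
  bernList≡applyUpTo (suc n) = ≡.trans (≡.cong (_++ (bernoulli n ∷ [])) (bernList≡applyUpTo n)) (List.applyUpTo-∷ʳ bernoulli n)

  zipWith-applyUpTo : ∀ {A B C : Set} (g : A → B → C) (f : ℕ → A) (h : ℕ → B) n →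
    zipWith g (applyUpTo f n) (applyUpTo h n) ≡ applyUpTo (λ j → g (f j) (h j)) n
  zipWith-applyUpTo g f h zero = ≡.refl
  zipWith-applyUpTo g f h (suc n) = ≡.cong (g (f 0) (h 0) ∷_) (zipWith-applyUpTo g (λ j → f (suc j)) (λ j → h (suc j)) n)

  bernoulli-recurrence : ∀ m → ∑[ k < suc (suc m) ] (ν (suc (suc m) C k) * B k) ≈ 0#
  bernoulli-recurrence m = begin
    S′ + ν (M C suc m) * B (suc m)  ≈⟨ +-congˡ (*-cong (reflexive (≡.cong ν MC[M∸1]≡M)) B[M∸1]) ⟩
    S′ + ν M * - (w * S′)           ≈⟨ +-congˡ (-‿distribʳ-* (ν M) (w * S′)) ⟨
    S′ + - (ν M * (w * S′))         ≈⟨ +-congˡ (-‿cong (trans (sym (*-assoc _ _ _)) (trans (*-congʳ ν[M]*w≈1) (*-identityˡ S′)))) ⟩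
    S′ + - S′                       ≈⟨ -‿inverseʳ S′ ⟩
    0#                              ∎
    where
    open SetoidReasoning setoid
    open import Algebra.Properties.Ring ring using (-‿distribʳ-*)
    M = suc (suc m)
    w = φ ((+ 1) / M)
    S′ = ∑[ k < suc m ] (ν (M C k) * B k)
    ν[M]*w≈1 : ν M * w ≈ 1#
    ν[M]*w≈1 = proj₂ (ν-invertible M)
    MC[M∸1]≡M : M C suc m ≡ M
    MC[M∸1]≡M = ≡.trans (nCk≡nC[n∸k] (ℕ.n≤1+n (suc m))) (≡.trans (≡.cong (M C_) (ℕ.m+n∸n≡m 1 (suc m))) (nC1≡n M))
    weighted : List ℚ
    weighted = zipWith (λ j b → ι (M C j) ℚ.* b) (upTo (suc m)) (bernList (suc m))
    φ-weighted : φ (Σℚ weighted) ≈ S′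
    φ-weighted = begin
      φ (Σℚ weighted)
        ≈⟨ φ-Σℚ weighted ⟩
      ΣR R φ (map φ weighted)
        ≡⟨ ≡.cong (λ xs → ΣR R φ (map φ xs)) (≡.trans (≡.cong (zipWith _ (upTo (suc m))) (bernList≡applyUpTo (suc m)))
                                                      (zipWith-applyUpTo _ (λ j → j) bernoulli (suc m))) ⟩
      ΣR R φ (map φ (applyUpTo (λ j → ι (M C j) ℚ.* bernoulli j) (suc m)))
        ≡⟨ ≡.cong (ΣR R φ) (List.map-applyUpTo (λ j → ι (M C j) ℚ.* bernoulli j) φ (suc m)) ⟩
      ΣR R φ (applyUpTo (λ j → φ (ι (M C j) ℚ.* bernoulli j)) (suc m))
        ≈⟨ ΣR-applyUpTo _ (suc m) ⟩
      ∑[ j < suc m ] φ (ι (M C j) ℚ.* bernoulli j)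
        ≈⟨ ∑-cong (suc m) (λ j _ → trans (*-homo _ _) (*-congʳ (φ∘ι≈ν (M C j)))) ⟩
      S′ ∎
    B[M∸1] : B (suc m) ≈ - (w * S′)
    B[M∸1] = trans (-‿homo _) (-‿cong (trans (*-homo _ _) (*-congˡ φ-weighted)))

  B⊛expm1[1]≋τ : B ⊛ expm1 1# ≋ τ
  B⊛expm1[1]≋τ n = begin
    ∑[ k < n ] (ν (n C k) * (B k * expm1 1# (n ∸ k))) + ν (n C n) * (B n * expm1 1# (n ∸ n))
      ≈⟨ +-cong (∑-cong n (λ k k<n → *-congˡ (trans (*-congˡ (expm1[1]-pos (n ∸ k) (ℕ.m<n⇒0<n∸m k<n))) (*-identityʳ _))))
                (trans (*-congˡ (trans (*-congˡ (reflexive (≡.cong (expm1 1#) (ℕ.n∸n≡0 n)))) (zeroʳ _))) (zeroʳ _)) ⟩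
    ∑[ k < n ] (ν (n C k) * B k) + 0#
      ≈⟨ +-identityʳ _ ⟩
    ∑[ k < n ] (ν (n C k) * B k)
      ≈⟨ lower-sum n ⟩
    τ n ∎
    where
    open SetoidReasoning setoid
    1^n≈1 : ∀ n → 1# ^ n ≈ 1#
    1^n≈1 zero = refl
    1^n≈1 (suc n) = trans (*-identityˡ _) (1^n≈1 n)
    expm1[1]-pos : ∀ m → 0 < m → expm1 1# m ≈ 1#
    expm1[1]-pos (suc m) _ = 1^n≈1 (suc m)
    lower-sum : ∀ n → ∑[ k < n ] (ν (n C k) * B k) ≈ τ n
    lower-sum zero = refl
    lower-sum (suc zero) = trans (+-identityˡ _) (trans (*-cong ν-1 1#-homo) (*-identityˡ _))
    lower-sum (suc (suc m)) = bernoulli-recurrence m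

  bernPoly≈B⊛exp : ∀ k z → bernPoly R φ k z ≈ (B ⊛ exp z) k
  bernPoly≈B⊛exp k z = begin
    ΣR R φ (map F (upTo (suc k)))                     ≈⟨ ΣR-map-upTo F (suc k) ⟩
    ∑ F (suc k)                                       ≈⟨ ∑-cong (suc k) (λ j _ → *-cong (φ-coefficient j) (^R≈^ z (k ∸ j))) ⟩
    ∑[ j < suc k ] ((ν (k C j) * B j) * z ^ (k ∸ j))  ≈⟨ ∑-cong (suc k) (λ j _ → *-assoc _ _ _) ⟩
    (B ⊛ exp z) k                                     ∎
    where
    open SetoidReasoning setoid
    F : ℕ → Carrier
    F j = φ (ι (k C j) ℚ.* bernoulli j) * _^R_ R φ z (k ∸ j)
    φ-coefficient : ∀ j → φ (ι (k C j) ℚ.* bernoulli j) ≈ ν (k C j) * B j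
    φ-coefficient j = trans (*-homo _ _) (*-congʳ (φ∘ι≈ν (k C j)))

  rescale-τ : ∀ s → rescale s τ ≋ s *ₗ τ
  rescale-τ s zero = trans (zeroʳ _) (sym (zeroʳ s))
  rescale-τ s (suc zero) = *-congʳ (*-identityʳ s)
  rescale-τ s (suc (suc n)) = trans (zeroʳ _) (sym (zeroʳ s))

  rescale[B⊛exp]⊛expm1 : ∀ s z → rescale s (B ⊛ exp z) ⊛ expm1 s ≋ s *ₗ (τ ⊛ exp (s * z))
  rescale[B⊛exp]⊛expm1 s z = begin
    rescale s (B ⊛ exp z) ⊛ expm1 s               ≈⟨ ⊛-cong (≋-refl {rescale s (B ⊛ exp z)}) expm1≋rescale ⟩
    rescale s (B ⊛ exp z) ⊛ rescale s (expm1 1#)  ≈⟨ rescale-⊛ s (B ⊛ exp z) (expm1 1#) ⟨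
    rescale s (B ⊛ exp z ⊛ expm1 1#)              ≈⟨ rescale-cong s (⊛-swapʳ B (exp z) (expm1 1#)) ⟩
    rescale s (B ⊛ expm1 1# ⊛ exp z)              ≈⟨ rescale-cong s (⊛-cong B⊛expm1[1]≋τ (≋-refl {exp z})) ⟩
    rescale s (τ ⊛ exp z)                         ≈⟨ rescale-⊛ s τ (exp z) ⟩
    rescale s τ ⊛ rescale s (exp z)               ≈⟨ ⊛-cong (rescale-τ s) (rescale-exp s z) ⟩
    (s *ₗ τ) ⊛ exp (s * z)                        ≈⟨ *ₗ-⊛ s τ (exp (s * z)) ⟩
    s *ₗ (τ ⊛ exp (s * z))                        ∎
    where
    open ≋-Reasoning
    expm1≋rescale : expm1 s ≋ rescale s (expm1 1#)
    expm1≋rescale = ≋-sym (≋-trans (rescale-expm1 s 1#) (expm1-cong (*-identityʳ s)))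
    ⊛-swapʳ : ∀ f g h → f ⊛ g ⊛ h ≋ f ⊛ h ⊛ g
    ⊛-swapʳ f g h = ≋-trans (⊛-assoc f g h) (≋-trans (⊛-cong (≋-refl {f}) (⊛-comm g h)) (≋-sym (⊛-assoc f h g)))

  powerSum : ℕ → Seq
  powerSum b l = ν (S l (b ∸ 1))

  rescale-powerSum : ∀ b .{{_ : NonZero b}} s → rescale s (powerSum b) ≋ ∑ₛ (λ i → exp (ν i * s)) b
  rescale-powerSum (suc N) s l = begin
    s ^ l * ν (sum (map (ℕ._^ l) (upTo (suc N))))  ≡⟨ ≡.cong (λ xs → s ^ l * ν (sum xs)) (List.map-upTo (ℕ._^ l) (suc N)) ⟩
    s ^ l * ν (sum (applyUpTo (ℕ._^ l) (suc N)))   ≈⟨ *-congˡ (ν-sum (ℕ._^ l) (suc N)) ⟩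
    s ^ l * ∑[ i < suc N ] ν (i ℕ.^ l)             ≈⟨ ∑-distribˡ (s ^ l) _ (suc N) ⟩
    ∑[ i < suc N ] (s ^ l * ν (i ℕ.^ l))           ≈⟨ ∑-cong (suc N) (λ i _ → s^l*ν[i^l]≈[νi*s]^l i) ⟩
    ∑ₛ (λ i → exp (ν i * s)) (suc N) l             ∎
    where
    open SetoidReasoning setoid
    ν-sum : ∀ h n → ν (sum (applyUpTo h n)) ≈ ∑[ i < n ] ν (h i)
    ν-sum h zero = refl
    ν-sum h (suc n) = trans (ν-+ (h 0) _) (trans (+-congˡ (ν-sum (λ i → h (suc i)) n)) (sym (∑-head (λ i → ν (h i)) n)))
    ν-^ : ∀ m l → ν (m ℕ.^ l) ≈ ν m ^ l
    ν-^ m zero = ν-1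
    ν-^ m (suc l) = trans (ν-* m (m ℕ.^ l)) (*-congˡ (ν-^ m l))
    s^l*ν[i^l]≈[νi*s]^l : ∀ i → s ^ l * ν (i ℕ.^ l) ≈ (ν i * s) ^ l
    s^l*ν[i^l]≈[νi*s]^l i = trans (*-comm _ _) (trans (*-congʳ (ν-^ i l)) (sym (^-distrib-* (ν i) s l)))

  clearDenominators : Carrier → Carrier → Carrier → Seq → Seq
  clearDenominators α β γ h = h ⊛ expm1 (β * γ) ⊛ expm1 (α * γ) ⊛ expm1 (α * β)

  clearDenominators-cong : ∀ α β γ {f g} → f ≋ g → clearDenominators α β γ f ≋ clearDenominators α β γ g
  clearDenominators-cong α β γ f≋g =
    ⊛-cong (⊛-cong (⊛-cong f≋g (≋-refl {expm1 (β * γ)})) (≋-refl {expm1 (α * γ)})) (≋-refl {expm1 (α * β)})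

  clearDenominators-*ₗ : ∀ α β γ a f → clearDenominators α β γ (a *ₗ f) ≋ a *ₗ clearDenominators α β γ f
  clearDenominators-*ₗ α β γ a f = ≋-trans
    (⊛-cong (≋-trans (⊛-cong (*ₗ-⊛ a f (expm1 (β * γ))) (≋-refl {expm1 (α * γ)})) (*ₗ-⊛ a _ (expm1 (α * γ))))
            (≋-refl {expm1 (α * β)}))
    (*ₗ-⊛ a _ (expm1 (α * β)))

  clearDenominators-rotate : ∀ α β γ h → clearDenominators β γ α h ≋ clearDenominators α β γ h
  clearDenominators-rotate α β γ h = ≋-trans
    (⊛-cong (⊛-cong (⊛-cong (≋-refl {h}) (expm1-cong (*-comm γ α))) (expm1-cong (*-comm β α))) (≋-refl {expm1 (β * γ)}))
    (rotate h (expm1 (β * γ)) (expm1 (α * γ)) (expm1 (α * β)))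
    where
    open ⊛-Solver
    rotate : ∀ h x y z → h ⊛ y ⊛ z ⊛ x ≋ h ⊛ x ⊛ y ⊛ z
    rotate = solve 4 (λ h x y z → ((h ⊕ y) ⊕ z) ⊕ x ⊜ ((h ⊕ x) ⊕ y) ⊕ z) ≋-refl

  clearDenominators-cancel : ∀ {α β γ f g} →
    RightInvertible 1# _*_ α → RightInvertible 1# _*_ β → RightInvertible 1# _*_ γ →
    clearDenominators α β γ f ≋ clearDenominators α β γ g → f ≋ g
  clearDenominators-cancel α⁻¹ β⁻¹ γ⁻¹ =
      ⊛-expm1-cancelʳ _ (invertible β⁻¹ γ⁻¹)
    ∘ ⊛-expm1-cancelʳ _ (invertible α⁻¹ γ⁻¹)
    ∘ ⊛-expm1-cancelʳ _ (invertible α⁻¹ β⁻¹)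
    where
    invertible : ∀ {x y} → RightInvertible 1# _*_ x → RightInvertible 1# _*_ y → ∀ n → RightInvertible 1# _*_ (ν (suc n) * (x * y))
    invertible x⁻¹ y⁻¹ n = invertible-* (ν-invertible (suc n)) (invertible-* x⁻¹ y⁻¹)

  -- the generating function t e^{ωyt} (e^{ωt} − 1)²
  cleared : Carrier → Carrier → Seq
  cleared ω y = τ ⊛ exp (ω * y) ⊛ (expm1 ω ⊛ expm1 ω)

  cleared-cong : ∀ {ω ω′} y → ω ≈ ω′ → cleared ω y ≋ cleared ω′ y
  cleared-cong y ω≈ω′ =
    ⊛-cong (⊛-cong (≋-refl {τ}) (exp-cong (*-congʳ ω≈ω′))) (⊛-cong (expm1-cong ω≈ω′) (expm1-cong ω≈ω′))

  module CyclicSum (a b c : ℕ) .{{_ : NonZero b}} .{{_ : NonZero c}} (y : Carrier) where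
    α β γ s₁ s₂ s₃ ω b⁻¹c⁻¹ : Carrier
    α = ν a
    β = ν b
    γ = ν c
    s₁ = β * γ
    s₂ = α * γ
    s₃ = α * β
    ω = α * (β * γ)
    b⁻¹c⁻¹ = φ ((+ 1) / b) * φ ((+ 1) / c)

    A P Q : Seq
    A = rescale s₁ (B ⊛ exp (α * y))
    P = rescale s₂ (powerSum b)
    Q = rescale s₃ (powerSum c)

    term : ℕ → ℕ → ℕ → Carrier
    term n k l = φ (multinom n k l m ℚ.* ι (S l (b ∸ 1)) ℚ.* ι (S m (c ∸ 1))
                      ℚ.* (ι a ^ℚ (l ℕ.+ m)) ℚ.* (ι b ^ℚ (k ℕ.+ m)) ℚ.* (ι c ^ℚ (k ℕ.+ l))
                      ℚ.* ((+ 1) / b) ℚ.* ((+ 1) / c))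
                 * bernPoly R φ k (φ (ι a) * y)
      where m = n ∸ k ∸ l

    term≈ : ∀ n k l → k ≤ n → l ≤ n ∸ k →
      term n k l ≈ b⁻¹c⁻¹ * (ν (n C k) * (A k * (ν ((n ∸ k) C l) * (P l * Q (n ∸ k ∸ l)))))
    term≈ n k l k≤n l≤n∸k = begin
      term n k l
        ≈⟨ *-cong (φ-*⁸ _ _ _ _ _ _ _ _)
                  (trans (bernPoly≈B⊛exp k _) (⊛-cong (≋-refl {B}) (exp-cong (*-congʳ (φ∘ι≈ν a))) k)) ⟩
      φ (multinom n k l m) * φ (ι SL) * φ (ι SM) * φ (ι a ^ℚ (l ℕ.+ m)) * φ (ι b ^ℚ (k ℕ.+ m)) * φ (ι c ^ℚ (k ℕ.+ l))
        * ib * ic * bp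
        ≈⟨ *-congʳ (*-congʳ (*-congʳ (*-cong (*-cong (*-cong (*-cong (*-cong (φ-multinom n k l k≤n l≤n∸k) (φ∘ι≈ν SL))
                                                                       (φ∘ι≈ν SM))
                                                              (power a l m))
                                                     (power b k m))
                                            (power c k l)))) ⟩
      ν C₁ * ν C₂ * ν SL * ν SM * (α ^ l * α ^ m) * (β ^ k * β ^ m) * (γ ^ k * γ ^ l) * ib * ic * bp
        ≈⟨ regroup _ _ _ _ _ _ _ _ _ _ _ _ _ ⟩
      (ib * ic) * (ν C₁ * (((β ^ k * γ ^ k) * bp) * (ν C₂ * (((α ^ l * γ ^ l) * ν SL) * ((α ^ m * β ^ m) * ν SM)))))
        ≈⟨ *-congˡ (*-congˡ (*-cong (*-congʳ (sym (^-distrib-* β γ k)))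
                                    (*-congˡ (*-cong (*-congʳ (sym (^-distrib-* α γ l))) (*-congʳ (sym (^-distrib-* α β m))))))) ⟩
      b⁻¹c⁻¹ * (ν C₁ * (A k * (ν C₂ * (P l * Q m)))) ∎
      where
      open SetoidReasoning setoid
      m = n ∸ k ∸ l
      C₁ = n C k
      C₂ = (n ∸ k) C l
      SL = S l (b ∸ 1)
      SM = S m (c ∸ 1)
      ib = φ ((+ 1) / b)
      ic = φ ((+ 1) / c)
      bp = (B ⊛ exp (α * y)) k
      power : ∀ x e f → φ (ι x ^ℚ (e ℕ.+ f)) ≈ ν x ^ e * ν x ^ f
      power x e f = trans (φ-ι^ℚ x (e ℕ.+ f)) (^-homo-* (ν x) e f)
      open *-Solver
      regroup : ∀ C₁ C₂ SL SM αˡ αᵐ βᵏ βᵐ γᵏ γˡ ib ic bp →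
        C₁ * C₂ * SL * SM * (αˡ * αᵐ) * (βᵏ * βᵐ) * (γᵏ * γˡ) * ib * ic * bp ≈
        (ib * ic) * (C₁ * (((βᵏ * γᵏ) * bp) * (C₂ * (((αˡ * γˡ) * SL) * ((αᵐ * βᵐ) * SM)))))
      regroup = solve 13 (λ C₁ C₂ SL SM αˡ αᵐ βᵏ βᵐ γᵏ γˡ ib ic bp →
        (((((((((C₁ ⊕ C₂) ⊕ SL) ⊕ SM) ⊕ (αˡ ⊕ αᵐ)) ⊕ (βᵏ ⊕ βᵐ)) ⊕ (γᵏ ⊕ γˡ)) ⊕ ib) ⊕ ic) ⊕ bp) ⊜
        (ib ⊕ ic) ⊕ (C₁ ⊕ (((βᵏ ⊕ γᵏ) ⊕ bp) ⊕ (C₂ ⊕ (((αˡ ⊕ γˡ) ⊕ SL) ⊕ ((αᵐ ⊕ βᵐ) ⊕ SM)))))) refl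

    cyclicSum≋ : cyclicSum R φ a b c y ≋ b⁻¹c⁻¹ *ₗ (A ⊛ (P ⊛ Q))
    cyclicSum≋ n = begin
      cyclicSum R φ a b c y n
        ≈⟨ ΣR-triples _ n ⟩
      ∑[ k < suc n ] ∑[ l < suc (n ∸ k) ] term n k l
        ≈⟨ ∑-cong (suc n) (λ k k<1+n → ∑-cong (suc (n ∸ k)) (λ l l<1+n∸k →
             term≈ n k l (ℕ.m<1+n⇒m≤n k<1+n) (ℕ.m<1+n⇒m≤n l<1+n∸k))) ⟩
      ∑[ k < suc n ] ∑[ l < suc (n ∸ k) ] (b⁻¹c⁻¹ * (ν (n C k) * (A k * (ν ((n ∸ k) C l) * (P l * Q (n ∸ k ∸ l))))))
        ≈⟨ ∑-cong (suc n) (λ k _ → distribute k) ⟨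
      ∑[ k < suc n ] (b⁻¹c⁻¹ * (ν (n C k) * (A k * (P ⊛ Q) (n ∸ k))))
        ≈⟨ ∑-distribˡ b⁻¹c⁻¹ _ (suc n) ⟨
      (b⁻¹c⁻¹ *ₗ (A ⊛ (P ⊛ Q))) n ∎
      where
      open SetoidReasoning setoid
      distribute : ∀ k → b⁻¹c⁻¹ * (ν (n C k) * (A k * (P ⊛ Q) (n ∸ k))) ≈
                         ∑[ l < suc (n ∸ k) ] (b⁻¹c⁻¹ * (ν (n C k) * (A k * (ν ((n ∸ k) C l) * (P l * Q (n ∸ k ∸ l))))))
      distribute k = trans (*-congˡ (trans (*-congˡ (∑-distribˡ (A k) _ (suc (n ∸ k)))) (∑-distribˡ (ν (n C k)) _ (suc (n ∸ k)))))
                           (∑-distribˡ b⁻¹c⁻¹ _ (suc (n ∸ k)))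

    A⊛expm1 : A ⊛ expm1 s₁ ≋ s₁ *ₗ (τ ⊛ exp (s₁ * (α * y)))
    A⊛expm1 = rescale[B⊛exp]⊛expm1 s₁ (α * y)

    P⊛expm1 : P ⊛ expm1 s₂ ≋ expm1 (β * s₂)
    P⊛expm1 = ≋-trans (⊛-cong (rescale-powerSum b s₂) (≋-refl {expm1 s₂})) (geometric-⊛-expm1 s₂ b)

    Q⊛expm1 : Q ⊛ expm1 s₃ ≋ expm1 (γ * s₃)
    Q⊛expm1 = ≋-trans (⊛-cong (rescale-powerSum c s₃) (≋-refl {expm1 s₃})) (geometric-⊛-expm1 s₃ c)

    A⊛[P⊛Q]-cleared : clearDenominators α β γ (A ⊛ (P ⊛ Q)) ≋ s₁ *ₗ cleared ω y
    A⊛[P⊛Q]-cleared = begin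
      A ⊛ (P ⊛ Q) ⊛ expm1 s₁ ⊛ expm1 s₂ ⊛ expm1 s₃
        ≈⟨ regroup A P Q (expm1 s₁) (expm1 s₂) (expm1 s₃) ⟩
      (A ⊛ expm1 s₁) ⊛ ((P ⊛ expm1 s₂) ⊛ (Q ⊛ expm1 s₃))
        ≈⟨ ⊛-cong A⊛expm1 (⊛-cong P⊛expm1 Q⊛expm1) ⟩
      (s₁ *ₗ (τ ⊛ exp (s₁ * (α * y)))) ⊛ (expm1 (β * s₂) ⊛ expm1 (γ * s₃))
        ≈⟨ *ₗ-⊛ s₁ (τ ⊛ exp (s₁ * (α * y))) (expm1 (β * s₂) ⊛ expm1 (γ * s₃)) ⟩
      s₁ *ₗ (τ ⊛ exp (s₁ * (α * y)) ⊛ (expm1 (β * s₂) ⊛ expm1 (γ * s₃)))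
        ≈⟨ *ₗ-congˡ s₁ (⊛-cong (⊛-cong (≋-refl {τ}) (exp-cong s₁αy≈ωy))
                               (⊛-cong (expm1-cong βs₂≈ω) (expm1-cong γs₃≈ω))) ⟩
      s₁ *ₗ cleared ω y ∎
      where
      open ≋-Reasoning
      open *-Solver using (solve; _⊕_; _⊜_)
      s₁αy≈ωy : s₁ * (α * y) ≈ ω * y
      s₁αy≈ωy = solve 4 (λ α β γ y → (β ⊕ γ) ⊕ (α ⊕ y) ⊜ (α ⊕ (β ⊕ γ)) ⊕ y) refl α β γ y
      βs₂≈ω : β * s₂ ≈ ω
      βs₂≈ω = solve 3 (λ α β γ → β ⊕ (α ⊕ γ) ⊜ α ⊕ (β ⊕ γ)) refl α β γ
      γs₃≈ω : γ * s₃ ≈ ω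
      γs₃≈ω = solve 3 (λ α β γ → γ ⊕ (α ⊕ β) ⊜ α ⊕ (β ⊕ γ)) refl α β γ
      regroup : ∀ a p q d₁ d₂ d₃ → a ⊛ (p ⊛ q) ⊛ d₁ ⊛ d₂ ⊛ d₃ ≋ (a ⊛ d₁) ⊛ ((p ⊛ d₂) ⊛ (q ⊛ d₃))
      regroup = ⊛-Solver.solve 6 (λ a p q d₁ d₂ d₃ →
        ((((a ⊛-Solver.⊕ (p ⊛-Solver.⊕ q)) ⊛-Solver.⊕ d₁) ⊛-Solver.⊕ d₂) ⊛-Solver.⊕ d₃)
          ⊛-Solver.⊜ ((a ⊛-Solver.⊕ d₁) ⊛-Solver.⊕ ((p ⊛-Solver.⊕ d₂) ⊛-Solver.⊕ (q ⊛-Solver.⊕ d₃)))) ≋-refl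

    b⁻¹c⁻¹*s₁≈1 : b⁻¹c⁻¹ * s₁ ≈ 1#
    b⁻¹c⁻¹*s₁≈1 = trans (interchange _ _ _ _)
      (trans (*-cong (trans (*-comm _ _) (proj₂ (ν-invertible b))) (trans (*-comm _ _) (proj₂ (ν-invertible c)))) (*-identityˡ 1#))
      where open import Algebra.Properties.CommutativeSemigroup *-commutativeSemigroup using (interchange)

    cyclicSum-cleared : clearDenominators α β γ (cyclicSum R φ a b c y) ≋ cleared ω y
    cyclicSum-cleared = begin
      clearDenominators α β γ (cyclicSum R φ a b c y)     ≈⟨ clearDenominators-cong α β γ cyclicSum≋ ⟩
      clearDenominators α β γ (b⁻¹c⁻¹ *ₗ (A ⊛ (P ⊛ Q)))  ≈⟨ clearDenominators-*ₗ α β γ b⁻¹c⁻¹ (A ⊛ (P ⊛ Q)) ⟩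
      b⁻¹c⁻¹ *ₗ clearDenominators α β γ (A ⊛ (P ⊛ Q))    ≈⟨ *ₗ-congˡ b⁻¹c⁻¹ A⊛[P⊛Q]-cleared ⟩
      b⁻¹c⁻¹ *ₗ (s₁ *ₗ cleared ω y)                      ≈⟨ *ₗ-assoc b⁻¹c⁻¹ s₁ (cleared ω y) ⟩
      (b⁻¹c⁻¹ * s₁) *ₗ cleared ω y                       ≈⟨ (λ n → trans (*-congʳ b⁻¹c⁻¹*s₁≈1) (*-identityˡ _)) ⟩
      cleared ω y                                         ∎
      where open ≋-Reasoning

  cyclicSum-rotate : ∀ a b c .{{_ : NonZero a}} .{{_ : NonZero b}} .{{_ : NonZero c}} y →
    cyclicSum R φ a b c y ≋ cyclicSum R φ b c a y
  cyclicSum-rotate a b c y = clearDenominators-cancel (ν-invertible a) (ν-invertible b) (ν-invertible c) (begin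
    clearDenominators α β γ (cyclicSum R φ a b c y)  ≈⟨ CyclicSum.cyclicSum-cleared a b c y ⟩
    cleared (α * (β * γ)) y                          ≈⟨ cleared-cong y (x∙yz≈y∙zx α β γ) ⟩
    cleared (β * (γ * α)) y                          ≈⟨ CyclicSum.cyclicSum-cleared b c a y ⟨
    clearDenominators β γ α (cyclicSum R φ b c a y)  ≈⟨ clearDenominators-rotate α β γ _ ⟩
    clearDenominators α β γ (cyclicSum R φ b c a y)  ∎)
    where
    open ≋-Reasoning
    open import Algebra.Properties.CommutativeSemigroup *-commutativeSemigroup using (x∙yz≈y∙zx)
    α = ν a
    β = ν b
    γ = ν c

theorem8 : {c ℓ : Level} (R : CommutativeRing c ℓ) (φ : ℚ → CommutativeRing.Carrier R)
    → IsRingHomomorphism +-*-rawRing (CommutativeRing.rawRing R) φ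
    → (p : ℕ) → Prime p
    → (w₁ w₂ w₃ : ℕ) → .{{_ : NonZero w₁}} → .{{_ : NonZero w₂}} → .{{_ : NonZero w₃}}
    → (y₁ : CommutativeRing.Carrier R) → (n : ℕ)
    → CommutativeRing._≈_ R (cyclicSum R φ w₁ w₂ w₃ y₁ n) (cyclicSum R φ w₂ w₃ w₁ y₁ n)
    × CommutativeRing._≈_ R (cyclicSum R φ w₂ w₃ w₁ y₁ n) (cyclicSum R φ w₃ w₁ w₂ y₁ n)
theorem8 R φ φ-hom _ _ w₁ w₂ w₃ y₁ n = cyclicSum-rotate w₁ w₂ w₃ y₁ n , cyclicSum-rotate w₂ w₃ w₁ y₁ n
  where open ℚ-Algebra R φ φ-hom
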